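{- Let $G$ be a finite simple connected graph. Then $G$ satisfies property (P2) if and only if $G$ is an extended block graph.
   Context: For a connected graph $G$, $d(u,v)$ denotes the shortest-path distance in $G$, $N(x)$ the set of neighbours of $x$, and $N[x]=N(x)\cup\{x\}$. For $c,x\in V(G)$ with $d(c,x)\ge 2$, let $N(c,x)=\{v\in N(c): d(c,x)=1+d(v,x)\}$ (the neighbours of $c$ lying on a shortest $c$–$x$ path). Property (P2): for any $c,x,y\in V(G)$ and any $c'\in N(c,x)$ with $d(c,x)\ge 2$ and $d(c',y)\ge 2$, either $d(c,y)=d(c,c')+d(c',y)$ or $d(x,y)=d(x,c')+d(c',y)$. A block graph is a connected graph in which every block (maximal 2-connected subgraph) is complete. An extended block graph is a connected graph obtained from a block graph by "blowing up" cut vertices: each cut vertex is replaced by a clique (a joint block), and every vertex of that clique is joined to every neighbour of the replaced cut vertex. -}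

module Defs where

open import Data.Nat using (ℕ; zero; suc; _+_; _≤_)
open import Data.Bool using (Bool; true; false)
open import Data.Fin using (Fin)
open import Data.Fin.Subset using (Subset; _∈_; _⊆_; ∣_∣)
open import Data.Product using (Σ; ∃; _×_; _,_)
open import Data.Sum using (_⊎_)
open import Relation.Nullary using (¬_)
open import Relation.Binary.PropositionalEquality using (_≡_; _≢_)
open import Function.Bundles using (_⇔_)

record Graph (n : ℕ) : Set where
  field
    adj   : Fin n → Fin n → Bool
    sym   : ∀ u v → adj u v ≡ adj v u
    irrefl : ∀ u → adj u u ≡ false

open Graph public

Adj : ∀ {n} → Graph n → Fin n → Fin n → Set
Adj G u v = adj G u v ≡ true

data Walk {n} (G : Graph n) : Fin n → Fin n → ℕ → Set where
  nil  : ∀ {u} → Walk G u u 0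
  cons : ∀ {u w v k} → Adj G u w → Walk G w v k → Walk G u v (suc k)

-- Walks all of whose vertices satisfy P (walks in the induced subgraph on P).
data WalkIn {n} (G : Graph n) (P : Fin n → Set) : Fin n → Fin n → Set where
  nil  : ∀ {u} → P u → WalkIn G P u u
  cons : ∀ {u w v} → P u → Adj G u w → WalkIn G P w v → WalkIn G P u v

Dist : ∀ {n} → Graph n → Fin n → Fin n → ℕ → Set
Dist G u v k = Walk G u v k × (∀ m → Walk G u v m → k ≤ m)

Connected : ∀ {n} → Graph n → Set
Connected G = ∀ u v → Σ ℕ (λ k → Walk G u v k)

-- Property (P2).  c' ∈ N(c,x) means: c' adjacent to c and d(c,x) = 1 + d(c',x).
P2 : ∀ {n} → Graph n → Set
P2 G = ∀ c x y c' (dcx dc'x dc'y : ℕ) →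
  Dist G c x dcx → 2 ≤ dcx →
  Adj G c c' → Dist G c' x dc'x → dcx ≡ suc dc'x →
  Dist G c' y dc'y → 2 ≤ dc'y →
  (∀ dcy dcc' → Dist G c y dcy → Dist G c c' dcc' → dcy ≡ dcc' + dc'y)
  ⊎ (∀ dxy dxc' → Dist G x y dxy → Dist G x c' dxc' → dxy ≡ dxc' + dc'y)

ConnectedOn : ∀ {n} → Graph n → (Fin n → Set) → Set
ConnectedOn G P = ∀ u v → P u → P v → WalkIn G P u v

TwoConnected : ∀ {n} → Graph n → Subset n → Set
TwoConnected G S =
  3 ≤ ∣ S ∣ × ConnectedOn G (_∈ S)
  × (∀ v → v ∈ S → ConnectedOn G (λ w → w ∈ S × w ≢ v))

IsBlock : ∀ {n} → Graph n → Subset n → Set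
IsBlock G S = TwoConnected G S × (∀ T → S ⊆ T → TwoConnected G T → T ⊆ S)

IsClique : ∀ {n} → Graph n → Subset n → Set
IsClique G S = ∀ u v → u ∈ S → v ∈ S → u ≢ v → Adj G u v

IsBlockGraph : ∀ {n} → Graph n → Set
IsBlockGraph G = Connected G × (∀ S → IsBlock G S → IsClique G S)

IsCutVertex : ∀ {n} → Graph n → Fin n → Set
IsCutVertex G v =
  Σ _ λ a → Σ _ λ b → a ≢ v × b ≢ v × ¬ WalkIn G (λ w → w ≢ v) a b

-- Extended block graph: G arises from a block graph H by replacing each cut
-- vertex h of H by a (nonempty) clique f⁻¹(h), every vertex of which is joined to
-- (every vertex replacing) each neighbour of h; non-cut vertices are kept as is.
IsExtendedBlockGraph : ∀ {n} → Graph n → Set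
IsExtendedBlockGraph {n} G =
  Σ ℕ λ m → Σ (Graph m) λ H → IsBlockGraph H ×
  Σ (Fin n → Fin m) λ f →
    (∀ h → Σ (Fin n) λ u → f u ≡ h)
  × (∀ u w → f u ≡ f w → ¬ IsCutVertex H (f u) → u ≡ w)
  × (∀ u w → Adj G u w ⇔ ((f u ≡ f w × u ≢ w) ⊎ Adj H (f u) (f w)))

-- In a block graph H, if a ∼ v and v lies on a geodesic from a to b ≠ v, every a–b walk passes
-- through v: a detour would put two non-adjacent neighbours of v on a common cycle, inside one
-- block, which is a clique.  Blowing H up into cliques of twins preserves distances between
-- different cliques, so in G every a–b walk meets the clique of v.  (P2) follows: unless a
-- geodesic from c or from x to y passes through the clique of c′, c and x are joined outside it.
-- Conversely, in a (P2) graph such walks must meet a twin of v (a walk avoiding them would cross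
-- from "closer to a" to "closer to v" along an edge, which (P2) and a diamond argument forbid).
-- Merging each non-simplicial vertex with its twins then yields H: the separation property makes
-- every block of H a clique and every merged vertex a cut vertex.

module Submission where

open import Defs hiding (sym)
open import Data.Bool using (Bool; true; false)
open import Data.Bool.Properties using (⇔→≡) renaming (_≟_ to _≟ᵇ_)
open import Data.Empty using (⊥; ⊥-elim)
open import Data.Fin using (Fin; zero; suc) renaming (_≟_ to _≟ᶠ_)
open import Data.Fin.Properties using (any?; all?) renaming (suc-injective to Fin-suc-injective)
open import Data.Fin.Subset using (Subset; _⊆_; ∣_∣) renaming (_∈_ to _∈ₛ_)
open import Data.Fin.Subset.Properties using (_∈?_; x∈p∧x≢y⇒x∈p-y; x∈p⇒∣p-x∣<∣p∣; p⊂q⇒∣p∣<∣q∣; ∣p∣≤n)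
open import Data.List using (List; []; _∷_; _++_; [_])
open import Data.List.Membership.Propositional using (_∈_; _∉_)
open import Data.List.Membership.Propositional.Properties using (∈-∃++; ∈-++⁻; ∈-++⁺ˡ; ∈-++⁺ʳ)
open import Data.List.Properties using (++-assoc)
open import Data.List.Relation.Unary.All as All using (All)
open import Data.List.Relation.Unary.All.Properties using (¬Any⇒All¬)
open import Data.List.Relation.Unary.AllPairs using ([]; _∷_)
open import Data.List.Relation.Unary.Any using (here; there) renaming (any? to anyˡ?)
open import Data.List.Relation.Unary.Linked using (Linked; []; [-]; _∷_) renaming (tail to linked-tail)
open import Data.List.Relation.Unary.Unique.Propositional using (Unique)
open import Data.Nat using (ℕ; zero; suc; _+_; _≤_; _<_; z≤n; s≤s; _≤?_)
open import Data.Nat.Properties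
open import Data.Product using (Σ; ∃; _×_; _,_; proj₁; proj₂)
open import Data.Sum as Sum using (_⊎_; inj₁; inj₂)
open import Data.Vec using (tabulate)
open import Data.Vec.Properties using (lookup∘tabulate; lookup⇒[]=; []=⇒lookup)
open import Function using (_∘_; id)
open import Function.Bundles using (_⇔_; mk⇔; Equivalence)
open import Relation.Nullary using (¬_; Dec; yes; no; does; contradiction)
open import Relation.Nullary.Decidable using (dec-true; decidable-stable; ¬?; _×-dec_; _⊎-dec_; _→-dec_; ¬¬-excluded-middle)
open import Relation.Unary using (Decidable)
open import Relation.Binary.Definitions using (Reflexive; Symmetric; Transitive) renaming (Decidable to Decidable₂)
open import Relation.Binary.PropositionalEquality hiding ([_])

least-witness : (P : ℕ → Set) → Decidable P → ∀ {k} → P k →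
                Σ ℕ λ m → P m × (∀ j → P j → m ≤ j)
least-witness P P? {zero} p = zero , p , λ _ _ → z≤n
least-witness P P? {suc _} p with P? zero
... | yes p₀ = zero , p₀ , λ _ _ → z≤n
... | no ¬p₀ with least-witness (P ∘ suc) (P? ∘ suc) p
...   | m , pm , least = suc m , pm , λ where
          zero p₀ → contradiction p₀ ¬p₀
          (suc j) pj → s≤s (least j pj)

module _ {A : Set} {R : A → A → Set} where

  linked-++⁻ˡ : ∀ xs {ys} → Linked R (xs ++ ys) → Linked R xs
  linked-++⁻ˡ [] _ = []
  linked-++⁻ˡ (_ ∷ []) _ = [-]
  linked-++⁻ˡ (_ ∷ y ∷ xs) (r ∷ l) = r ∷ linked-++⁻ˡ (y ∷ xs) l

  linked-++⁻ʳ : ∀ xs {ys} → Linked R (xs ++ ys) → Linked R ys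
  linked-++⁻ʳ [] l = l
  linked-++⁻ʳ (_ ∷ xs) l = linked-++⁻ʳ xs (linked-tail l)

  linked-join : ∀ xs {y ys} → Linked R (xs ++ [ y ]) → Linked R (y ∷ ys) → Linked R (xs ++ y ∷ ys)
  linked-join [] _ l = l
  linked-join (_ ∷ []) (r ∷ _) l = r ∷ l
  linked-join (_ ∷ x′ ∷ xs) (r ∷ l′) l = r ∷ linked-join (x′ ∷ xs) l′ l

Unique-middle : ∀ {A : Set} xs {x : A} ys → Unique (xs ++ x ∷ ys) → x ∉ xs × x ∉ ys
Unique-middle [] ys (x∉ys ∷ _) = (λ ()) , λ x∈ys → All.lookup x∉ys x∈ys refl
Unique-middle (x′ ∷ xs) ys (x′∉ ∷ unique) with Unique-middle xs ys unique
... | x∉xs , x∉ys = (λ { (here refl) → All.lookup x′∉ (∈-++⁺ʳ xs (here refl)) refl ; (there x∈) → x∉xs x∈ }) , x∉ys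

record FinQuotient (n : ℕ) (R : Fin n → Fin n → Set) : Set where
  field
    size                 : ℕ
    class                : Fin n → Fin size
    representative       : Fin size → Fin n
    class∘representative : ∀ h → class (representative h) ≡ h
    sound                : ∀ {u w} → class u ≡ class w → R u w
    complete             : ∀ {u w} → R u w → class u ≡ class w

quotient : ∀ n {R : Fin n → Fin n → Set} → Decidable₂ R → Reflexive R → Symmetric R → Transitive R →
           FinQuotient n R
quotient zero _ _ _ _ = record
  { size = 0 ; class = λ () ; representative = λ () ; class∘representative = λ ()
  ; sound = λ { {()} } ; complete = λ { {()} } }
quotient (suc n) {R} R? R-refl R-sym R-trans with any? (λ i → R? zero (suc i))
... | yes (i , R0i) = record
  { size = size ; class = class′ ; representative = suc ∘ representative
  ; class∘representative = class∘representative ; sound = sound′ ; complete = complete′ }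
  where
  open FinQuotient (quotient n (λ u w → R? (suc u) (suc w)) R-refl R-sym R-trans)
  class′ : Fin (suc n) → Fin size
  class′ zero = class i
  class′ (suc j) = class j
  sound′ : ∀ {u w} → class′ u ≡ class′ w → R u w
  sound′ {zero} {zero} _ = R-refl
  sound′ {zero} {suc _} e = R-trans R0i (sound e)
  sound′ {suc _} {zero} e = R-sym (R-trans R0i (sound (sym e)))
  sound′ {suc _} {suc _} e = sound e
  complete′ : ∀ {u w} → R u w → class′ u ≡ class′ w
  complete′ {zero} {zero} _ = refl
  complete′ {zero} {suc _} r = complete (R-trans (R-sym R0i) r)
  complete′ {suc _} {zero} r = complete (R-trans r R0i)
  complete′ {suc _} {suc _} r = complete r
... | no ¬R0 = record
  { size = suc size ; class = class′ ; representative = representative′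
  ; class∘representative = class∘representative′ ; sound = sound′ ; complete = complete′ }
  where
  open FinQuotient (quotient n (λ u w → R? (suc u) (suc w)) R-refl R-sym R-trans)
  class′ : Fin (suc n) → Fin (suc size)
  class′ zero = zero
  class′ (suc j) = suc (class j)
  representative′ : Fin (suc size) → Fin (suc n)
  representative′ zero = zero
  representative′ (suc h) = suc (representative h)
  class∘representative′ : ∀ h → class′ (representative′ h) ≡ h
  class∘representative′ zero = refl
  class∘representative′ (suc h) = cong suc (class∘representative h)
  sound′ : ∀ {u w} → class′ u ≡ class′ w → R u w
  sound′ {zero} {zero} _ = R-refl
  sound′ {suc _} {suc _} e = sound (Fin-suc-injective e)
  complete′ : ∀ {u w} → R u w → class′ u ≡ class′ w
  complete′ {zero} {zero} _ = refl
  complete′ {zero} {suc j} r = contradiction (j , r) ¬R0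
  complete′ {suc j} {zero} r = contradiction (j , R-sym r) ¬R0
  complete′ {suc _} {suc _} r = cong suc (complete r)

module Walks {n : ℕ} (G : Graph n) where

  Adj-sym : ∀ {u v} → Adj G u v → Adj G v u
  Adj-sym {u} {v} = trans (Graph.sym G v u)

  Adj-irrefl : ∀ {u} → ¬ Adj G u u
  Adj-irrefl {u} e with trans (sym (Graph.irrefl G u)) e
  ... | ()

  Adj⇒≢ : ∀ {u v} → Adj G u v → u ≢ v
  Adj⇒≢ e refl = Adj-irrefl e

  Adj? : ∀ u v → Dec (Adj G u v)
  Adj? u v = adj G u v ≟ᵇ true

  walk-snoc : ∀ {u v w k} → Walk G u v k → Adj G v w → Walk G u w (suc k)
  walk-snoc nil e = cons e nil
  walk-snoc (cons e′ p) e = cons e′ (walk-snoc p e)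

  walk-reverse : ∀ {u v k} → Walk G u v k → Walk G v u k
  walk-reverse nil = nil
  walk-reverse (cons e p) = walk-snoc (walk-reverse p) (Adj-sym e)

  infixr 5 _++ʷ_ _++ⁱ_

  _++ʷ_ : ∀ {u v w k l} → Walk G u v k → Walk G v w l → Walk G u w (k + l)
  nil ++ʷ q = q
  cons e p ++ʷ q = cons e (p ++ʷ q)

  walk? : ∀ k u v → Dec (Walk G u v k)
  walk? zero u v with u ≟ᶠ v
  ... | yes refl = yes nil
  ... | no u≢v = no λ { nil → u≢v refl }
  walk? (suc k) u v with any? (λ w → Adj? u w ×-dec walk? k w v)
  ... | yes (w , e , p) = yes (cons e p)
  ... | no ∄w = no λ { (cons {w = w} e p) → ∄w (w , e , p) }

  _∈ʷ_ : ∀ {u v k} → Fin n → Walk G u v k → Set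
  z ∈ʷ nil {u} = z ≡ u
  z ∈ʷ cons {u} _ p = z ≡ u ⊎ z ∈ʷ p

  walk-split : ∀ {u v k z} (p : Walk G u v k) → z ∈ʷ p →
               Σ ℕ λ i → Σ ℕ λ j → Walk G u z i × Walk G z v j × i + j ≡ k
  walk-split nil refl = 0 , 0 , nil , nil , refl
  walk-split (cons e p) (inj₁ refl) = 0 , _ , nil , cons e p , refl
  walk-split (cons e p) (inj₂ z∈p) with walk-split p z∈p
  ... | i , j , p₁ , p₂ , eq = suc i , j , cons e p₁ , p₂ , cong suc eq

  walk-find : ∀ {Q : Fin n → Set} → Decidable Q → ∀ {u v k} (p : Walk G u v k) →
              (Σ (Fin n) λ z → z ∈ʷ p × Q z) ⊎ WalkIn G (¬_ ∘ Q) u v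
  walk-find Q? {u} nil with Q? u
  ... | yes q = inj₁ (u , refl , q)
  ... | no ¬q = inj₂ (nil ¬q)
  walk-find Q? {u} (cons e p) with Q? u
  ... | yes q = inj₁ (u , inj₁ refl , q)
  ... | no ¬q with walk-find Q? p
  ...   | inj₁ (z , z∈p , q) = inj₁ (z , inj₂ z∈p , q)
  ...   | inj₂ p′ = inj₂ (cons ¬q e p′)

  walkIn-snoc : ∀ {P u v w} → WalkIn G P u v → Adj G v w → P w → WalkIn G P u w
  walkIn-snoc (nil pu) e pw = cons pu e (nil pw)
  walkIn-snoc (cons pu e′ p) e pw = cons pu e′ (walkIn-snoc p e pw)

  walkIn-reverse : ∀ {P u v} → WalkIn G P u v → WalkIn G P v u
  walkIn-reverse (nil pu) = nil pu
  walkIn-reverse (cons pu e p) = walkIn-snoc (walkIn-reverse p) (Adj-sym e) pu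

  _++ⁱ_ : ∀ {P u v w} → WalkIn G P u v → WalkIn G P v w → WalkIn G P u w
  nil _ ++ⁱ q = q
  cons pu e p ++ⁱ q = cons pu e (p ++ⁱ q)

  walkIn-map : ∀ {P Q : Fin n → Set} → (∀ {z} → P z → Q z) →
               ∀ {u v} → WalkIn G P u v → WalkIn G Q u v
  walkIn-map f (nil pu) = nil (f pu)
  walkIn-map f (cons pu e p) = cons (f pu) e (walkIn-map f p)

  walkIn-head : ∀ {P u v} → WalkIn G P u v → P u
  walkIn-head (nil pu) = pu
  walkIn-head (cons pu _ _) = pu

  walkIn-last : ∀ {P u v} → WalkIn G P u v → P v
  walkIn-last (nil pu) = pu
  walkIn-last (cons _ _ p) = walkIn-last p

  walkIn-crossing : ∀ {P Q : Fin n → Set} → Decidable Q → ∀ {u w} → WalkIn G P u w → Q u → ¬ Q w →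
                    Σ (Fin n) λ y → Σ (Fin n) λ y′ → P y × P y′ × Adj G y y′ × Q y × ¬ Q y′
  walkIn-crossing Q? (nil pu) qu ¬qw = contradiction qu ¬qw
  walkIn-crossing Q? (cons {w = w} pu e p) qu ¬qw with Q? w
  ... | yes qw = walkIn-crossing Q? p qw ¬qw
  ... | no ¬q = _ , w , pu , walkIn-head p , e , qu , ¬q

module Twins {n : ℕ} (G : Graph n) where
  open Walks G

  -- Closed twins: N[u] = N[w].
  Twin : Fin n → Fin n → Set
  Twin u w = (u ≡ w ⊎ Adj G u w) × (∀ z → z ≢ u → z ≢ w → adj G u z ≡ adj G w z)

  Twin? : ∀ u w → Dec (Twin u w)
  Twin? u w = ((u ≟ᶠ w) ⊎-dec Adj? u w) ×-dec
              all? (λ z → ¬? (z ≟ᶠ u) →-dec (¬? (z ≟ᶠ w) →-dec (adj G u z ≟ᵇ adj G w z)))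

  Twin-refl : ∀ {u} → Twin u u
  Twin-refl = inj₁ refl , λ _ _ _ → refl

  Twin-sym : ∀ {u w} → Twin u w → Twin w u
  Twin-sym (u≡w , same) = Sum.map sym Adj-sym u≡w , λ z z≢w z≢u → sym (same z z≢u z≢w)

  Twin-adj : ∀ {t c z} → Twin t c → z ≢ t → Adj G c z → Adj G t z
  Twin-adj (_ , same) z≢t cz = trans (same _ z≢t (Adj⇒≢ cz ∘ sym)) cz

  Twin⇒Adj : ∀ {t c} → Twin t c → t ≢ c → Adj G t c
  Twin⇒Adj (inj₁ t≡c , _) t≢c = contradiction t≡c t≢c
  Twin⇒Adj (inj₂ e , _) _ = e

  Twin-trans : ∀ {u v w} → Twin u v → Twin v w → Twin u w
  Twin-trans {u} {v} {w} tuv tvw with u ≟ᶠ w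
  ... | yes refl = Twin-refl
  ... | no u≢w = inj₂ uw , same
    where
    uw : Adj G u w
    uw with u ≟ᶠ v | v ≟ᶠ w
    ... | yes refl | _ = Twin⇒Adj tvw u≢w
    ... | no u≢v | yes refl = Twin⇒Adj tuv u≢v
    ... | no u≢v | no v≢w = Twin-adj tuv (u≢w ∘ sym) (Twin⇒Adj tvw v≢w)
    same : ∀ z → z ≢ u → z ≢ w → adj G u z ≡ adj G w z
    same z z≢u z≢w with z ≟ᶠ v
    ... | no z≢v = trans (proj₂ tuv z z≢u z≢v) (proj₂ tvw z z≢v z≢w)
    ... | yes refl = trans (Twin⇒Adj tuv (z≢u ∘ sym)) (sym (Adj-sym (Twin⇒Adj tvw z≢w)))

  NonSimplicial : Fin n → Set
  NonSimplicial v = Σ (Fin n) λ a → Σ (Fin n) λ b → Adj G v a × Adj G v b × a ≢ b × ¬ Adj G a b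

  NonSimplicial? : ∀ v → Dec (NonSimplicial v)
  NonSimplicial? v = any? λ a → any? λ b →
    Adj? v a ×-dec Adj? v b ×-dec ¬? (a ≟ᶠ b) ×-dec ¬? (Adj? a b)

  NonSimplicial-twin : ∀ {u w} → Twin u w → NonSimplicial u → NonSimplicial w
  NonSimplicial-twin {u} {w} tw (a , b , ua , ub , a≢b , ¬ab) =
    a , b , transfer ua ub a≢b ¬ab , transfer ub ua (a≢b ∘ sym) (¬ab ∘ Adj-sym) , a≢b , ¬ab
    where
    transfer : ∀ {a b} → Adj G u a → Adj G u b → a ≢ b → ¬ Adj G a b → Adj G w a
    transfer {a} ua ub a≢b ¬ab = Twin-adj (Twin-sym tw) a≢w ua
      where
      a≢w : a ≢ w
      a≢w refl = ¬ab (Twin-adj (Twin-sym tw) (a≢b ∘ sym) ub)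

module Distance {n : ℕ} {G : Graph n} (conn : Connected G) where
  open Walks G
  open Twins G

  private
    shortest : ∀ u v → Σ ℕ λ k → Walk G u v k × (∀ j → Walk G u v j → k ≤ j)
    shortest u v = least-witness (λ k → Walk G u v k) (λ k → walk? k u v) (proj₂ (conn u v))

  d : Fin n → Fin n → ℕ
  d u v = proj₁ (shortest u v)

  d-Dist : ∀ u v → Dist G u v (d u v)
  d-Dist u v = proj₂ (shortest u v)

  geodesic : ∀ u v → Walk G u v (d u v)
  geodesic u v = proj₁ (d-Dist u v)

  d-minimal : ∀ {u v k} → Walk G u v k → d u v ≤ k
  d-minimal p = proj₂ (d-Dist _ _) _ p

  Dist⇒≡d : ∀ {u v k} → Dist G u v k → k ≡ d u v
  Dist⇒≡d (p , minimal) = ≤-antisym (minimal _ (geodesic _ _)) (d-minimal p)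

  d-triangle : ∀ u v w → d u w ≤ d u v + d v w
  d-triangle u v w = d-minimal (geodesic u v ++ʷ geodesic v w)

  d-sym : ∀ u v → d u v ≡ d v u
  d-sym u v = ≤-antisym (d-minimal (walk-reverse (geodesic v u))) (d-minimal (walk-reverse (geodesic u v)))

  d-refl : ∀ u → d u u ≡ 0
  d-refl u = n≤0⇒n≡0 (d-minimal (nil {u = u}))

  d≡0⇒≡ : ∀ {u v} → d u v ≡ 0 → u ≡ v
  d≡0⇒≡ {u} {v} d≡0 with d u v | geodesic u v
  d≡0⇒≡ refl | .0 | nil = refl

  Adj⇒d≡1 : ∀ {u v} → Adj G u v → d u v ≡ 1
  Adj⇒d≡1 {u} {v} e with d u v in d≡ | d-minimal (cons e nil)
  ... | zero | _ = contradiction (d≡0⇒≡ d≡) (Adj⇒≢ e)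
  ... | suc zero | _ = refl
  ... | suc (suc _) | s≤s ()

  d≡1⇒Adj : ∀ {u v} → d u v ≡ 1 → Adj G u v
  d≡1⇒Adj {u} {v} d≡1 with d u v | geodesic u v
  d≡1⇒Adj refl | .1 | cons e nil = e

  ≢⇒d≥1 : ∀ {u v} → u ≢ v → 1 ≤ d u v
  ≢⇒d≥1 {u} {v} u≢v with d u v in d≡
  ... | zero = contradiction (d≡0⇒≡ d≡) u≢v
  ... | suc _ = s≤s z≤n

  d≥2⇒≢ : ∀ {u v} → 2 ≤ d u v → u ≢ v
  d≥2⇒≢ {u} 2≤d refl = <⇒≱ 2≤d (≤-trans (≤-reflexive (d-refl u)) z≤n)

  d≥2⇒¬Adj : ∀ {u v} → 2 ≤ d u v → ¬ Adj G u v
  d≥2⇒¬Adj 2≤d e = <⇒≱ 2≤d (≤-reflexive (Adj⇒d≡1 e))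

  ≢∧¬Adj⇒d≥2 : ∀ {u v} → u ≢ v → ¬ Adj G u v → 2 ≤ d u v
  ≢∧¬Adj⇒d≥2 {u} {v} u≢v ¬uv with d u v in d≡
  ... | zero = contradiction (d≡0⇒≡ d≡) u≢v
  ... | suc zero = contradiction (d≡1⇒Adj d≡) ¬uv
  ... | suc (suc _) = s≤s (s≤s z≤n)

  d≡2 : ∀ {u v w} → u ≢ w → ¬ Adj G u w → Adj G u v → Adj G v w → d u w ≡ 2
  d≡2 {u} {_} {w} u≢w ¬uw uv vw with d u w in d≡ | d-minimal (cons uv (cons vw nil))
  ... | zero | _ = contradiction (d≡0⇒≡ d≡) u≢w
  ... | suc zero | _ = contradiction (d≡1⇒Adj d≡) ¬uw
  ... | suc (suc zero) | _ = refl
  ... | suc (suc (suc _)) | s≤s (s≤s ())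

  d-on-geodesic : ∀ {u w t} → t ∈ʷ geodesic u w → d u t + d t w ≡ d u w
  d-on-geodesic {u} {w} {t} t∈ with walk-split (geodesic u w) t∈
  ... | i , j , p₁ , p₂ , i+j≡ =
    ≤-antisym (subst (d u t + d t w ≤_) i+j≡ (+-mono-≤ (d-minimal p₁) (d-minimal p₂))) (d-triangle u t w)

  geodesic-tail-avoids : ∀ {v w b k} → Walk G w b k → suc k ≤ d v b → WalkIn G (_≢ v) w b
  geodesic-tail-avoids {v} p k<d with walk-find (_≟ᶠ v) p
  ... | inj₂ p′ = p′
  ... | inj₁ (.v , v∈p , refl) with walk-split p v∈p
  ...   | i , j , _ , p₂ , i+j≡k =
    contradiction (≤-trans (d-minimal p₂) (subst (j ≤_) i+j≡k (m≤n+m j i))) (<⇒≱ k<d)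

  first-on-geodesic : ∀ {a b} → 1 ≤ d a b → Σ (Fin n) λ v → Adj G a v × d a b ≡ suc (d v b)
  first-on-geodesic {a} {b} 1≤dab with d a b in dab | geodesic a b
  ... | suc k | cons {w = v} av rest =
    v , av , cong suc (≤-antisym (≤-pred (subst (_≤ suc (d v b)) dab (d-minimal (cons av (geodesic v b)))))
                                 (d-minimal rest))

  -- q is the successor of v on a geodesic from v to b.
  next-on-geodesic : ∀ {a v b} → Adj G a v → d a b ≡ suc (d v b) → 1 ≤ d v b →
                     Σ (Fin n) λ q → Adj G v q × 2 ≤ d a q × WalkIn G (_≢ v) q b
  next-on-geodesic {a} {v} {b} av dab 1≤dvb with d v b in dvb | geodesic v b
  ... | suc k | cons {w = q} vq rest =
    q , vq , +-cancelʳ-≤ k 2 (d a q) 2+k≤ , geodesic-tail-avoids rest (≤-reflexive (sym dvb))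
    where
    2+k≤ : 2 + k ≤ d a q + k
    2+k≤ = begin
      2 + k           ≡⟨ sym dab ⟩
      d a b           ≤⟨ d-triangle a q b ⟩
      d a q + d q b   ≤⟨ +-monoʳ-≤ (d a q) (d-minimal rest) ⟩
      d a q + k       ∎
      where open ≤-Reasoning

  geodesic-interior-NonSimplicial : ∀ {a v b} → Adj G a v → d a b ≡ suc (d v b) → 1 ≤ d v b →
                                   NonSimplicial v
  geodesic-interior-NonSimplicial av dab 1≤dvb with next-on-geodesic av dab 1≤dvb
  ... | q , vq , 2≤daq , _ = _ , q , Adj-sym av , vq , d≥2⇒≢ 2≤daq , d≥2⇒¬Adj 2≤daq

  Twin⇒d≤1 : ∀ {u w} → Twin u w → d u w ≤ 1
  Twin⇒d≤1 (inj₁ refl , _) = ≤-trans (≤-reflexive (d-refl _)) z≤n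
  Twin⇒d≤1 (inj₂ e , _) = ≤-reflexive (Adj⇒d≡1 e)

  Twin-d≥ : ∀ {t c z} → Twin t c → z ≢ t → d c z ≤ d t z
  Twin-d≥ {t} {c} {z} tw z≢t with d t z | geodesic t z
  ... | zero | nil = contradiction refl z≢t
  ... | suc k | cons {w = w} e rest with w ≟ᶠ c
  ...   | yes refl = m≤n⇒m≤1+n (d-minimal rest)
  ...   | no w≢c = d-minimal (cons (trans (sym (proj₂ tw w (Adj⇒≢ e ∘ sym) w≢c)) e) rest)

  Twin-d : ∀ {t c z} → Twin t c → z ≢ t → z ≢ c → d t z ≡ d c z
  Twin-d tw z≢t z≢c = ≤-antisym (Twin-d≥ (Twin-sym tw) z≢c) (Twin-d≥ tw z≢t)

  Twin-d-outside : ∀ {t c z} → Twin t c → ¬ Twin z c → d z t ≡ d z c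
  Twin-d-outside {t} {c} {z} tw ¬tw = begin
    d z t ≡⟨ d-sym z t ⟩
    d t z ≡⟨ Twin-d tw (λ { refl → ¬tw tw }) (λ { refl → ¬tw Twin-refl }) ⟩
    d c z ≡⟨ d-sym c z ⟩
    d z c ∎
    where open ≡-Reasoning

  -- (P2) in terms of d, with d(c,c′) = 1 substituted since c ∼ c′.
  P2ᵈ : Set
  P2ᵈ = ∀ {c x y c′} → Adj G c c′ → 2 ≤ d c x → d c x ≡ suc (d c′ x) → 2 ≤ d c′ y →
        d c y ≡ suc (d c′ y) ⊎ d x y ≡ d x c′ + d c′ y

  P2ᵈ⇒P2 : P2ᵈ → P2 G
  P2ᵈ⇒P2 p2 c x y c′ _ _ _ Dcx 2≤dcx cc′ Dc′x dcx≡ Dc′y 2≤dc′y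
    with Dist⇒≡d Dcx | Dist⇒≡d Dc′x | Dist⇒≡d Dc′y
  ... | refl | refl | refl with p2 cc′ 2≤dcx dcx≡ 2≤dc′y
  ...   | inj₁ dcy≡ = inj₁ λ _ _ Dcy Dcc′ →
          trans (Dist⇒≡d Dcy) (trans dcy≡ (cong (_+ d c′ y) (sym (trans (Dist⇒≡d Dcc′) (Adj⇒d≡1 cc′)))))
  ...   | inj₂ dxy≡ = inj₂ λ _ _ Dxy Dxc′ →
          trans (Dist⇒≡d Dxy) (trans dxy≡ (cong (_+ d c′ y) (sym (Dist⇒≡d Dxc′))))

  P2⇒P2ᵈ : P2 G → P2ᵈ
  P2⇒P2ᵈ p2 {c} {x} {y} {c′} cc′ 2≤dcx dcx≡ 2≤dc′y =
    Sum.map (λ h → trans (h _ _ (d-Dist c y) (d-Dist c c′)) (cong (_+ d c′ y) (Adj⇒d≡1 cc′)))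
            (λ h → h _ _ (d-Dist x y) (d-Dist x c′))
            (p2 c x y c′ _ _ _ (d-Dist c x) 2≤dcx cc′ (d-Dist c′ x) dcx≡ (d-Dist c′ y) 2≤dc′y)

module Cycles {n : ℕ} (G : Graph n) where
  open Walks G

  subsetOf : List (Fin n) → Subset n
  subsetOf L = tabulate λ z → does (anyˡ? (z ≟ᶠ_) L)

  ∈-subsetOf⁺ : ∀ L {z} → z ∈ L → z ∈ₛ subsetOf L
  ∈-subsetOf⁺ L {z} z∈L = lookup⇒[]= z (subsetOf L) (trans (lookup∘tabulate _ z) (dec-true (anyˡ? (z ≟ᶠ_) L) z∈L))

  ∈-subsetOf⁻ : ∀ L {z} → z ∈ₛ subsetOf L → z ∈ L
  ∈-subsetOf⁻ L {z} z∈S with anyˡ? (z ≟ᶠ_) L | trans (sym (lookup∘tabulate (λ z → does (anyˡ? (z ≟ᶠ_) L)) z)) ([]=⇒lookup z∈S)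
  ... | yes z∈L | _ = z∈L
  ... | no _ | ()

  ∣∣≥3 : ∀ {S : Subset n} {p q r} → p ∈ₛ S → q ∈ₛ S → r ∈ₛ S → p ≢ q → p ≢ r → q ≢ r → 3 ≤ ∣ S ∣
  ∣∣≥3 p∈ q∈ r∈ p≢q p≢r q≢r =
    ≤-trans (s≤s (≤-trans (s≤s (≤-trans (s≤s z≤n) (x∈p⇒∣p-x∣<∣p∣ r∈S-p-q))) (x∈p⇒∣p-x∣<∣p∣ q∈S-p)))
            (x∈p⇒∣p-x∣<∣p∣ p∈)
    where
    q∈S-p = x∈p∧x≢y⇒x∈p-y q∈ (p≢q ∘ sym)
    r∈S-p-q = x∈p∧x≢y⇒x∈p-y (x∈p∧x≢y⇒x∈p-y r∈ (p≢r ∘ sym)) (q≢r ∘ sym)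

  linked-walkIn : ∀ {L} → Linked (Adj G) L → ∀ {u w} → u ∈ L → w ∈ L → WalkIn G (_∈ L) u w
  linked-walkIn {_ ∷ _} l u∈ w∈ = walkIn-reverse (from-head l u∈) ++ⁱ from-head l w∈
    where
    from-head : ∀ {x L w} → Linked (Adj G) (x ∷ L) → w ∈ x ∷ L → WalkIn G (_∈ x ∷ L) x w
    from-head _ (here refl) = nil (here refl)
    from-head (e ∷ l) (there w∈) = cons (here refl) e (walkIn-map there (from-head l w∈))

  linked-ConnectedOn : ∀ {P : Fin n → Set} {L} → Linked (Adj G) L →
                       (∀ {w} → P w → w ∈ L) → (∀ {w} → w ∈ L → P w) → ConnectedOn G P
  linked-ConnectedOn l into onto u w pu pw = walkIn-map onto (linked-walkIn l (into pu) (into pw))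

  cycle-TwoConnected : ∀ {v L a q} → Linked (Adj G) (v ∷ L ++ [ v ]) → Unique (v ∷ L) →
                       a ∈ L → q ∈ L → a ≢ q → TwoConnected G (subsetOf (v ∷ L))
  cycle-TwoConnected {v} {L} cycle (v∉L ∷ unique) a∈ q∈ a≢q =
    ∣∣≥3 (∈-subsetOf⁺ (v ∷ L) (here refl)) (∈-subsetOf⁺ (v ∷ L) (there a∈)) (∈-subsetOf⁺ (v ∷ L) (there q∈)) (v≢ a∈) (v≢ q∈) a≢q ,
    linked-ConnectedOn (linked-++⁻ˡ (v ∷ L) cycle) (∈-subsetOf⁻ (v ∷ L)) (∈-subsetOf⁺ (v ∷ L)) ,
    deletion
    where
    v≢ : ∀ {z} → z ∈ L → v ≢ z
    v≢ z∈ = All.lookup v∉L z∈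

    deletion : ∀ z → z ∈ₛ subsetOf (v ∷ L) → ConnectedOn G (λ w → w ∈ₛ subsetOf (v ∷ L) × w ≢ z)
    deletion z z∈ with ∈-subsetOf⁻ (v ∷ L) z∈
    ... | here refl = linked-ConnectedOn (linked-++⁻ˡ L (linked-tail cycle)) into onto
      where
      into : ∀ {w} → w ∈ₛ subsetOf (v ∷ L) × w ≢ v → w ∈ L
      into (w∈ , w≢v) with ∈-subsetOf⁻ (v ∷ L) w∈
      ... | here w≡v = contradiction w≡v w≢v
      ... | there w∈L = w∈L
      onto : ∀ {w} → w ∈ L → w ∈ₛ subsetOf (v ∷ L) × w ≢ v
      onto w∈L = ∈-subsetOf⁺ (v ∷ L) (there w∈L) , v≢ w∈L ∘ sym
    ... | there z∈L with ∈-∃++ z∈L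
    ...   | A , B , refl = linked-ConnectedOn rest into onto
      where
      cycle′ : Linked (Adj G) ((v ∷ A) ++ z ∷ B ++ [ v ])
      cycle′ = subst (λ C → Linked (Adj G) (v ∷ C)) (++-assoc A (z ∷ B) [ v ]) cycle
      rest : Linked (Adj G) (B ++ v ∷ A)
      rest = linked-join B (linked-tail (linked-++⁻ʳ (v ∷ A) cycle′)) (linked-++⁻ˡ (v ∷ A) cycle′)
      into : ∀ {w} → w ∈ₛ subsetOf (v ∷ A ++ z ∷ B) × w ≢ z → w ∈ B ++ v ∷ A
      into (w∈ , w≢z) with ∈-subsetOf⁻ (v ∷ A ++ z ∷ B) w∈
      ... | here refl = ∈-++⁺ʳ B (here refl)
      ... | there w∈′ with ∈-++⁻ A w∈′
      ...   | inj₁ w∈A = ∈-++⁺ʳ B (there w∈A)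
      ...   | inj₂ (here w≡z) = contradiction w≡z w≢z
      ...   | inj₂ (there w∈B) = ∈-++⁺ˡ w∈B
      onto : ∀ {w} → w ∈ B ++ v ∷ A → w ∈ₛ subsetOf (v ∷ A ++ z ∷ B) × w ≢ z
      onto w∈ with ∈-++⁻ B w∈ | Unique-middle A B unique
      ... | inj₁ w∈B | _ , z∉B = ∈-subsetOf⁺ (v ∷ A ++ z ∷ B) (there (∈-++⁺ʳ A (there w∈B))) , λ { refl → z∉B w∈B }
      ... | inj₂ (here refl) | _ = ∈-subsetOf⁺ (v ∷ A ++ z ∷ B) (here refl) , v≢ z∈L
      ... | inj₂ (there w∈A) | z∉A , _ = ∈-subsetOf⁺ (v ∷ A ++ z ∷ B) (there (∈-++⁺ˡ w∈A)) , λ { refl → z∉A w∈A }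

  vertices : ∀ {P u w} → WalkIn G P u w → List (Fin n)
  vertices (nil {u} _) = u ∷ []
  vertices (cons {u} _ _ p) = u ∷ vertices p

  vertices-All : ∀ {P u w} (p : WalkIn G P u w) → All P (vertices p)
  vertices-All (nil pu) = pu All.∷ All.[]
  vertices-All (cons pu _ p) = pu All.∷ vertices-All p

  ∈-vertices-head : ∀ {P u w} (p : WalkIn G P u w) → u ∈ vertices p
  ∈-vertices-head (nil _) = here refl
  ∈-vertices-head (cons _ _ _) = here refl

  ∈-vertices-last : ∀ {P u w} (p : WalkIn G P u w) → w ∈ vertices p
  ∈-vertices-last (nil _) = here refl
  ∈-vertices-last (cons _ _ p) = there (∈-vertices-last p)

  vertices-snoc : ∀ {P u w v} (p : WalkIn G P u w) → Adj G w v → Linked (Adj G) (vertices p ++ [ v ])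
  vertices-snoc (nil _) wv = wv ∷ [-]
  vertices-snoc (cons _ e (nil _)) wv = e ∷ wv ∷ [-]
  vertices-snoc (cons _ e p@(cons _ _ _)) wv = e ∷ vertices-snoc p wv

  vertices-cycle : ∀ {P u w v} (p : WalkIn G P u w) → Adj G v u → Adj G w v → Linked (Adj G) (v ∷ vertices p ++ [ v ])
  vertices-cycle p@(nil _) vu wv = vu ∷ vertices-snoc p wv
  vertices-cycle p@(cons _ _ _) vu wv = vu ∷ vertices-snoc p wv

  walkIn-suffix : ∀ {P u w z} (p : WalkIn G P u w) → z ∈ vertices p →
                  Σ (WalkIn G P z w) λ q → Unique (vertices p) → Unique (vertices q)
  walkIn-suffix (nil pu) (here refl) = nil pu , id
  walkIn-suffix (cons pu e p) (here refl) = cons pu e p , id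
  walkIn-suffix (cons _ _ p) (there z∈) with walkIn-suffix p z∈
  ... | q , unique = q , λ { (_ ∷ u) → unique u }

  walkIn-path : ∀ {P u w} → WalkIn G P u w → Σ (WalkIn G P u w) λ q → Unique (vertices q)
  walkIn-path (nil pu) = nil pu , All.[] ∷ []
  walkIn-path (cons {u} pu e p) with walkIn-path p
  ... | q , unique with anyˡ? (u ≟ᶠ_) (vertices q)
  ...   | yes u∈q = proj₁ (walkIn-suffix q u∈q) , proj₂ (walkIn-suffix q u∈q) unique
  ...   | no u∉q = cons pu e q , ¬Any⇒All¬ _ u∉q ∷ unique

  -- Decidability of T ⊆ S is enough to pick a maximal 2-connected superset,
  -- but 2-connectivity itself is not decidable, hence the double negation.
  block-extension : ∀ k S → n ≤ ∣ S ∣ + k → TwoConnected G S →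
                    ¬ ¬ (Σ (Subset n) λ T → S ⊆ T × IsBlock G T)
  block-extension k S room tcS ¬block = ¬¬-excluded-middle {A = LargerTwoConnected} λ where
      (yes (T , S⊆T , tcT , x , x∈T , x∉S)) → grow k {T} room (p⊂q⇒∣p∣<∣q∣ ((λ {y} → S⊆T {y}) , x , x∈T , x∉S)) S⊆T tcT
      (no ¬larger) → ¬block (S , (λ x∈ → x∈) , tcS , maximal ¬larger)
    where
    LargerTwoConnected : Set
    LargerTwoConnected = Σ (Subset n) λ T → S ⊆ T × TwoConnected G T × ∃ λ x → x ∈ₛ T × ¬ x ∈ₛ S
    maximal : ¬ LargerTwoConnected →
              ∀ T → S ⊆ T → TwoConnected G T → T ⊆ S
    maximal ¬larger T S⊆T tcT {x} x∈T with x ∈? S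
    ... | yes x∈S = x∈S
    ... | no x∉S = contradiction (T , (λ {y} → S⊆T {y}) , tcT , x , x∈T , x∉S) ¬larger
    grow : ∀ k {T} → n ≤ ∣ S ∣ + k → ∣ S ∣ < ∣ T ∣ → S ⊆ T → TwoConnected G T → ⊥
    grow zero {T} room′ ∣S∣<∣T∣ _ _ =
      <⇒≱ (<-≤-trans (s≤s (subst (n ≤_) (+-identityʳ _) room′)) ∣S∣<∣T∣) (∣p∣≤n T)
    grow (suc k) {T} room′ ∣S∣<∣T∣ S⊆T tcT =
      block-extension k T (≤-trans room′ (≤-trans (≤-reflexive (+-suc _ k)) (+-monoˡ-≤ k ∣S∣<∣T∣))) tcT
        λ (U , T⊆U , blockU) → ¬block (U , (λ x∈ → T⊆U (S⊆T x∈)) , blockU)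

module BlockGraphs {m : ℕ} {H : Graph m} (bg : IsBlockGraph H) where
  open Walks H
  open Cycles H
  open Distance (proj₁ bg)

  -- a and q lie on a common cycle through v, whose block would have to be a clique.
  neighbours-separated : ∀ {v a q} → Adj H v a → Adj H v q → a ≢ q → ¬ Adj H a q →
                         ¬ WalkIn H (_≢ v) a q
  neighbours-separated {v} {a} {q} va vq a≢q ¬aq w with walkIn-path w
  ... | p , unique =
    block-extension m (subsetOf (v ∷ vertices p)) (m≤n+m m _)
      (cycle-TwoConnected (vertices-cycle p va (Adj-sym vq)) (v∉p ∷ unique)
                          (∈-vertices-head p) (∈-vertices-last p) a≢q)
      λ (T , S⊆T , blockT) → ¬aq (proj₂ bg T blockT a q (S⊆T (∈-subsetOf⁺ (v ∷ vertices p) (there (∈-vertices-head p))))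
                                                          (S⊆T (∈-subsetOf⁺ (v ∷ vertices p) (there (∈-vertices-last p)))) a≢q)
    where
    v∉p : All (v ≢_) (vertices p)
    v∉p = All.map (_∘ sym) (vertices-All p)

  geodesic-vertex-separates : ∀ {a v b} → Adj H a v → d a b ≡ suc (d v b) → 1 ≤ d v b →
                              ¬ WalkIn H (_≢ v) a b
  geodesic-vertex-separates av dab 1≤dvb w with next-on-geodesic av dab 1≤dvb
  ... | q , vq , 2≤daq , q↝b =
    neighbours-separated (Adj-sym av) vq (d≥2⇒≢ 2≤daq) (d≥2⇒¬Adj 2≤daq) (w ++ⁱ walkIn-reverse q↝b)

-- G is obtained from H by blowing up the vertices of H into the cliques f⁻¹(h);
-- s picks a vertex of each of them.
module BlowUp {n m : ℕ} (G : Graph n) (H : Graph m) (f : Fin n → Fin m) (s : Fin m → Fin n)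
              (f∘s : ∀ h → f (s h) ≡ h)
              (adj⇔ : ∀ u w → Adj G u w ⇔ ((f u ≡ f w × u ≢ w) ⊎ Adj H (f u) (f w))) where
  open Walks G
  open Twins G

  Adj⇒ : ∀ {u w} → Adj G u w → (f u ≡ f w × u ≢ w) ⊎ Adj H (f u) (f w)
  Adj⇒ = Equivalence.to (adj⇔ _ _)

  ⇒Adj : ∀ {u w} → (f u ≡ f w × u ≢ w) ⊎ Adj H (f u) (f w) → Adj G u w
  ⇒Adj = Equivalence.from (adj⇔ _ _)

  fibre-Twin : ∀ {t c} → f t ≡ f c → Twin t c
  fibre-Twin {t} {c} ft≡fc with t ≟ᶠ c
  ... | yes t≡c = inj₁ t≡c , λ z _ _ → cong (λ c′ → adj G c′ z) t≡c
  ... | no t≢c = inj₂ (⇒Adj (inj₁ (ft≡fc , t≢c))) , λ z z≢t z≢c →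
      ⇔→≡ (mk⇔ (⇒Adj ∘ transfer z≢t z≢c ft≡fc ∘ Adj⇒) (⇒Adj ∘ transfer z≢c z≢t (sym ft≡fc) ∘ Adj⇒))
    where
    transfer : ∀ {a b z} → z ≢ a → z ≢ b → f a ≡ f b → (f a ≡ f z × a ≢ z) ⊎ Adj H (f a) (f z) →
               (f b ≡ f z × b ≢ z) ⊎ Adj H (f b) (f z)
    transfer _ z≢b fa≡fb (inj₁ (fa≡fz , _)) = inj₁ (trans (sym fa≡fb) fa≡fz , z≢b ∘ sym)
    transfer {z = z} _ _ fa≡fb (inj₂ e) = inj₂ (subst (λ h → Adj H h (f z)) fa≡fb e)

  walk-image : ∀ {u v k} → Walk G u v k → Σ ℕ λ k′ → k′ ≤ k × Walk H (f u) (f v) k′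
  walk-image nil = 0 , z≤n , nil
  walk-image {v = v} (cons e p) with walk-image p | Adj⇒ e
  ... | k′ , k′≤ , q | inj₁ (fu≡fw , _) = k′ , m≤n⇒m≤1+n k′≤ , subst (λ h → Walk H h (f v) k′) (sym fu≡fw) q
  ... | k′ , k′≤ , q | inj₂ e′ = suc k′ , s≤s k′≤ , cons e′ q

  walkIn-image : ∀ {P : Fin n → Set} {Q : Fin m → Set} → (∀ {z} → P z → Q (f z)) →
                 ∀ {u v} → WalkIn G P u v → WalkIn H Q (f u) (f v)
  walkIn-image g (nil pu) = nil (g pu)
  walkIn-image {Q = Q} g {v = v} (cons {u} {w} pu e p) with f u ≟ᶠ f w | Adj⇒ e
  ... | yes fu≡fw | _ = subst (λ h → WalkIn H Q h (f v)) (sym fu≡fw) (walkIn-image g p)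
  ... | no fu≢fw | inj₁ (fu≡fw , _) = contradiction fu≡fw fu≢fw
  ... | no _ | inj₂ e′ = cons (g pu) e′ (walkIn-image g p)

  connected-image : Connected G → Connected H
  connected-image conn h h′ with walk-image (proj₂ (conn (s h) (s h′)))
  ... | k , _ , p = k , subst₂ (λ a b → Walk H a b k) (f∘s h) (f∘s h′) p

  Adj-lift : ∀ {h k} → Adj H h k → Adj G (s h) (s k)
  Adj-lift {h} {k} e = ⇒Adj (inj₂ (subst₂ (Adj H) (sym (f∘s h)) (sym (f∘s k)) e))

  walk-lift : ∀ {h h′ k u w} → Walk H h h′ (suc k) → f u ≡ h → f w ≡ h′ → Walk G u w (suc k)
  walk-lift (cons e nil) refl refl = cons (⇒Adj (inj₂ e)) nil
  walk-lift {u = u} (cons {w = h₁} e p@(cons _ _)) refl fw≡ =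
    cons (⇒Adj (inj₂ (subst (Adj H (f u)) (sym (f∘s h₁)) e))) (walk-lift p (f∘s h₁) fw≡)

  walkIn-lift : ∀ {Q : Fin m → Set} {P : Fin n → Set} → (∀ {h} → Q h → P (s h)) →
                ∀ {h h′} → WalkIn H Q h h′ → WalkIn G P (s h) (s h′)
  walkIn-lift g (nil q) = nil (g q)
  walkIn-lift g (cons q e p) = cons (g q) (Adj-lift e) (walkIn-lift g p)

  walkIn-to-representative : ∀ {P : Fin n → Set} {u} → P u → P (s (f u)) → WalkIn G P u (s (f u))
  walkIn-to-representative {P} {u} pu ps with u ≟ᶠ s (f u)
  ... | yes u≡ = subst (WalkIn G P u) u≡ (nil pu)
  ... | no u≢ = cons pu (⇒Adj (inj₁ (sym (f∘s (f u)) , u≢))) (nil ps)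

module ExtendedBlockGraph⇒P2 {n m : ℕ} {G : Graph n} {H : Graph m} (conn : Connected G) (bg : IsBlockGraph H)
    (f : Fin n → Fin m) (s : Fin m → Fin n) (f∘s : ∀ h → f (s h) ≡ h)
    (adj⇔ : ∀ u w → Adj G u w ⇔ ((f u ≡ f w × u ≢ w) ⊎ Adj H (f u) (f w))) where
  open Walks G
  open Twins G
  open Distance conn
  open BlowUp G H f s f∘s adj⇔
  open BlockGraphs bg using (geodesic-vertex-separates)
  module Hᵈ = Distance (proj₁ bg)

  d-image : ∀ {u w} → f u ≢ f w → Hᵈ.d (f u) (f w) ≡ d u w
  d-image {u} {w} fu≢fw = ≤-antisym image≤ ≤lift
    where
    image≤ : Hᵈ.d (f u) (f w) ≤ d u w
    image≤ with walk-image (geodesic u w)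
    ... | _ , k≤ , p = ≤-trans (Hᵈ.d-minimal p) k≤
    ≤lift : d u w ≤ Hᵈ.d (f u) (f w)
    ≤lift with Hᵈ.d (f u) (f w) in d≡ | Hᵈ.geodesic (f u) (f w)
    ... | zero | _ = contradiction (Hᵈ.d≡0⇒≡ d≡) fu≢fw
    ... | suc _ | p = d-minimal (walk-lift p refl refl)

  fibre-separates : ∀ {a v b} → Adj G a v → d a b ≡ suc (d v b) → 1 ≤ d v b →
                    ¬ WalkIn G (λ z → f z ≢ f v) a b
  fibre-separates {a} {v} {b} av dab 1≤dvb w =
    geodesic-vertex-separates avᴴ dabᴴ (subst (1 ≤_) (sym dvbᴴ) 1≤dvb) (walkIn-image id w)
    where
    fb≢fv : f b ≢ f v
    fb≢fv = walkIn-last w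
    avᴴ : Adj H (f a) (f v)
    avᴴ with Adj⇒ av
    ... | inj₁ (fa≡fv , _) = contradiction fa≡fv (walkIn-head w)
    ... | inj₂ e = e
    fa≢fb : f a ≢ f b
    fa≢fb fa≡fb = <⇒≱ (s≤s 1≤dvb) (subst (_≤ 1) dab (Twin⇒d≤1 (fibre-Twin fa≡fb)))
    dvbᴴ : Hᵈ.d (f v) (f b) ≡ d v b
    dvbᴴ = d-image (fb≢fv ∘ sym)
    dabᴴ : Hᵈ.d (f a) (f b) ≡ suc (Hᵈ.d (f v) (f b))
    dabᴴ = trans (d-image fa≢fb) (trans dab (cong suc (sym dvbᴴ)))

  module _ {c x y c′} (cc′ : Adj G c c′) (2≤dcx : 2 ≤ d c x) (dcx≡ : d c x ≡ suc (d c′ x))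
           (2≤dc′y : 2 ≤ d c′ y) where

    ¬Twin-y : ¬ Twin y c′
    ¬Twin-y tw = <⇒≱ 2≤dc′y (subst (_≤ 1) (d-sym y c′) (Twin⇒d≤1 tw))

    ¬Twin-x : ¬ Twin x c′
    ¬Twin-x tw = <⇒≱ 2≤dcx (≤-reflexive (Adj⇒d≡1 (Adj-sym (Twin-adj tw (d≥2⇒≢ 2≤dcx) (Adj-sym cc′)))))

    ¬Twin-c : ¬ Twin c c′
    ¬Twin-c tw = 1+n≢n (trans (sym dcx≡) (Twin-d tw (d≥2⇒≢ 2≤dcx ∘ sym) λ { refl → ¬Twin-x Twin-refl }))

    through-twin : ∀ {u t} → ¬ Twin u c′ → t ∈ʷ geodesic u y → f t ≡ f c′ → d u y ≡ d u c′ + d c′ y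
    through-twin {u} {t} ¬tw t∈ ft≡ = begin
      d u y           ≡⟨ sym (d-on-geodesic t∈) ⟩
      d u t + d t y   ≡⟨ cong₂ _+_ (Twin-d-outside tw ¬tw) (trans (d-sym t y) (Twin-d-outside tw ¬Twin-y)) ⟩
      d u c′ + d y c′ ≡⟨ cong (d u c′ +_) (d-sym y c′) ⟩
      d u c′ + d c′ y ∎
      where
      open ≡-Reasoning
      tw = fibre-Twin ft≡

    -- Either a geodesic from c or from x to y meets the clique f⁻¹(f c′) of twins of c′,
    -- or c and x are joined outside it.
    p2-at : d c y ≡ suc (d c′ y) ⊎ d x y ≡ d x c′ + d c′ y
    p2-at with walk-find (λ z → f z ≟ᶠ f c′) (geodesic c y)
    ... | inj₁ (t , t∈ , ft≡) = inj₁ (trans (through-twin ¬Twin-c t∈ ft≡) (cong (_+ d c′ y) (Adj⇒d≡1 cc′)))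
    ... | inj₂ c↝y with walk-find (λ z → f z ≟ᶠ f c′) (geodesic x y)
    ...   | inj₁ (t , t∈ , ft≡) = inj₂ (through-twin ¬Twin-x t∈ ft≡)
    ...   | inj₂ x↝y = ⊥-elim (fibre-separates cc′ dcx≡ (≤-pred (subst (2 ≤_) dcx≡ 2≤dcx))
                                                (c↝y ++ⁱ walkIn-reverse x↝y))

  p2 : P2 G
  p2 = P2ᵈ⇒P2 p2-at

module P2Graphs {n : ℕ} {G : Graph n} (conn : Connected G) (p2 : P2 G) where
  open Walks G
  open Twins G
  open Distance conn

  private
    p2ᵈ : P2ᵈ
    p2ᵈ = P2⇒P2ᵈ p2

  diamond-neighbour : ∀ {a v y y′ z} → Adj G a v → Adj G a y → Adj G v y → Adj G y′ v → Adj G y′ y →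
                      a ≢ y′ → ¬ Adj G a y′ → Adj G v z → z ≢ y → Adj G y z
  diamond-neighbour {a} {_} {y} {y′} {z} av ay vy y′v y′y a≢y′ ¬ay′ vz z≢y =
    decidable-stable (Adj? y z) λ ¬yz → too-far ¬yz (p2ᵈ ay (≤-reflexive (sym day′)) day′≡ (≤-reflexive (sym (dyz ¬yz))))
    where
    day′ : d a y′ ≡ 2
    day′ = d≡2 a≢y′ ¬ay′ av (Adj-sym y′v)
    day′≡ : d a y′ ≡ suc (d y y′)
    day′≡ = trans day′ (cong suc (sym (Adj⇒d≡1 (Adj-sym y′y))))
    dyz : ¬ Adj G y z → d y z ≡ 2
    dyz ¬yz = d≡2 (z≢y ∘ sym) ¬yz (Adj-sym vy) vz
    too-far : (¬yz : ¬ Adj G y z) → d a z ≡ suc (d y z) ⊎ d y′ z ≡ d y′ y + d y z → ⊥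
    too-far ¬yz (inj₁ daz≡) =
      <⇒≱ (≤-reflexive (sym (trans daz≡ (cong suc (dyz ¬yz))))) (d-minimal (cons av (cons vz nil)))
    too-far ¬yz (inj₂ dy′z≡) =
      <⇒≱ (≤-reflexive (sym (trans dy′z≡ (cong₂ _+_ (Adj⇒d≡1 y′y) (dyz ¬yz))))) (d-minimal (cons y′v (cons vz nil)))

  diamond⇒Twin : ∀ {a v y y′} → Adj G a v → Adj G a y → Adj G v y → Adj G y′ v → Adj G y′ y →
                 a ≢ y′ → ¬ Adj G a y′ → Twin v y
  diamond⇒Twin av ay vy y′v y′y a≢y′ ¬ay′ = inj₂ vy , λ z z≢v z≢y →
    ⇔→≡ (mk⇔ (λ vz → diamond-neighbour av ay vy y′v y′y a≢y′ ¬ay′ vz z≢y)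
             (λ yz → diamond-neighbour ay av (Adj-sym vy) y′y y′v a≢y′ ¬ay′ yz z≢v))

  -- An edge y y′ on which "closer to a than to v" switches to "closer to v" is impossible:
  -- far from v it contradicts (P2), next to v it spans a diamond making y a twin of v.
  crossing-impossible : ∀ {a v y y′} → Adj G a v → Adj G y y′ → ¬ Twin y v → ¬ Twin y′ v →
                        d a y ≤ d v y → d v y′ < d a y′ → ⊥
  crossing-impossible {a} {v} {y} {y′} av yy′ ¬tw-y ¬tw-y′ day≤ dvy′< = by-cases (2 ≤? d v y)
    where
    1≤dvy′ : 1 ≤ d v y′
    1≤dvy′ = ≢⇒d≥1 λ { refl → ¬tw-y′ Twin-refl }
    day′≡ : d a y′ ≡ suc (d v y′)
    day′≡ = ≤-antisym (≤-trans (d-triangle a v y′) (≤-reflexive (cong (_+ d v y′) (Adj⇒d≡1 av)))) dvy′<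
    far : 2 ≤ d v y → d a y ≡ suc (d v y) ⊎ d y′ y ≡ d y′ v + d v y → ⊥
    far _ (inj₁ day≡) = <⇒≱ (≤-reflexive (sym day≡)) day≤
    far 2≤dvy (inj₂ dy′y≡) =
      <⇒≱ (≤-trans 2≤dvy (≤-trans (m≤n+m (d v y) (d y′ v)) (≤-reflexive (sym dy′y≡))))
          (≤-reflexive (Adj⇒d≡1 (Adj-sym yy′)))
    near : d v y ≤ 1 → ⊥
    near dvy≤1 = ¬tw-y (Twin-sym (diamond⇒Twin av ay vy (Adj-sym vy′) (Adj-sym yy′) a≢y′ ¬ay′))
      where
      vy : Adj G v y
      vy = d≡1⇒Adj (≤-antisym dvy≤1 (≢⇒d≥1 λ { refl → ¬tw-y Twin-refl }))
      day≤1 : d a y ≤ 1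
      day≤1 = ≤-trans day≤ dvy≤1
      dvy′≡1 : d v y′ ≡ 1
      dvy′≡1 = ≤-antisym (≤-pred (subst (_≤ 2) day′≡ (≤-trans (d-triangle a y y′)
                                  (+-mono-≤ day≤1 (≤-reflexive (Adj⇒d≡1 yy′)))))) 1≤dvy′
      vy′ : Adj G v y′
      vy′ = d≡1⇒Adj dvy′≡1
      2≤day′ : 2 ≤ d a y′
      2≤day′ = ≤-reflexive (sym (trans day′≡ (cong suc dvy′≡1)))
      a≢y′ : a ≢ y′
      a≢y′ = d≥2⇒≢ 2≤day′
      ¬ay′ : ¬ Adj G a y′
      ¬ay′ = d≥2⇒¬Adj 2≤day′
      ay : Adj G a y
      ay = d≡1⇒Adj (≤-antisym day≤1 (≢⇒d≥1 λ { refl → ¬ay′ yy′ }))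
    by-cases : Dec (2 ≤ d v y) → ⊥
    by-cases (yes 2≤dvy) = far 2≤dvy (p2ᵈ av (≤-trans (s≤s 1≤dvy′) (≤-reflexive (sym day′≡))) day′≡ 2≤dvy)
    by-cases (no 2≰dvy) = near (≤-pred (≰⇒> 2≰dvy))

  twins-separate : ∀ {a v b} → Adj G a v → d a b ≡ suc (d v b) → ¬ WalkIn G (λ z → ¬ Twin z v) a b
  twins-separate {a} {v} {b} av dab w
    with walkIn-crossing (λ z → d a z ≤? d v z) w (subst (_≤ d v a) (sym (d-refl a)) z≤n)
                                                  (λ dab≤ → 1+n≰n (subst (_≤ d v b) dab dab≤))
  ... | y , y′ , ¬tw-y , ¬tw-y′ , yy′ , day≤ , day′≰ = crossing-impossible av yy′ ¬tw-y ¬tw-y′ day≤ (≰⇒> day′≰)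

module P2⇒ExtendedBlockGraph {n : ℕ} {G : Graph n} (conn : Connected G) (p2 : P2 G) where
  open Walks G
  open Twins G
  open Distance conn
  open P2Graphs conn p2

  -- The joint blocks are the twin classes of non-simplicial vertices.  Simplicial twins
  -- are kept apart: they are distinct vertices of a single block of the block graph.
  _≈_ : Fin n → Fin n → Set
  u ≈ w = u ≡ w ⊎ (Twin u w × NonSimplicial u)

  ≈-sym : Symmetric _≈_
  ≈-sym (inj₁ u≡w) = inj₁ (sym u≡w)
  ≈-sym (inj₂ (tw , ns)) = inj₂ (Twin-sym tw , NonSimplicial-twin tw ns)

  ≈-trans : Transitive _≈_
  ≈-trans (inj₁ refl) r = r
  ≈-trans r (inj₁ refl) = r
  ≈-trans (inj₂ (tw₁ , ns)) (inj₂ (tw₂ , _)) = inj₂ (Twin-trans tw₁ tw₂ , ns)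

  ≈⇒Twin : ∀ {u w} → u ≈ w → Twin u w
  ≈⇒Twin (inj₁ refl) = Twin-refl
  ≈⇒Twin (inj₂ (tw , _)) = tw

  open FinQuotient (quotient n (λ u w → (u ≟ᶠ w) ⊎-dec (Twin? u w ×-dec NonSimplicial? u))
                             (inj₁ refl) ≈-sym ≈-trans)

  Twin-representative : ∀ u → Twin (representative (class u)) u
  Twin-representative u = ≈⇒Twin (sound (class∘representative (class u)))

  adjᴴ : Fin size → Fin size → Bool
  adjᴴ h k with h ≟ᶠ k
  ... | yes _ = false
  ... | no _ = adj G (representative h) (representative k)

  H : Graph size
  H = record { adj = adjᴴ ; sym = adjᴴ-sym ; irrefl = adjᴴ-irrefl }
    where
    adjᴴ-sym : ∀ h k → adjᴴ h k ≡ adjᴴ k h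
    adjᴴ-sym h k with h ≟ᶠ k | k ≟ᶠ h
    ... | yes _ | yes _ = refl
    ... | yes h≡k | no k≢h = contradiction (sym h≡k) k≢h
    ... | no h≢k | yes k≡h = contradiction (sym k≡h) h≢k
    ... | no _ | no _ = Graph.sym G (representative h) (representative k)
    adjᴴ-irrefl : ∀ h → adjᴴ h h ≡ false
    adjᴴ-irrefl h with h ≟ᶠ h
    ... | yes _ = refl
    ... | no h≢h = contradiction refl h≢h

  Adjᴴ⇔ : ∀ h k → Adj H h k ⇔ (h ≢ k × Adj G (representative h) (representative k))
  Adjᴴ⇔ h k with h ≟ᶠ k
  ... | yes h≡k = mk⇔ (λ ()) λ (h≢k , _) → contradiction h≡k h≢k
  ... | no h≢k = mk⇔ (h≢k ,_) proj₂

  representative≢ : ∀ {u w} → class u ≢ class w → representative (class u) ≢ w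
  representative≢ {u} cu≢cw refl = cu≢cw (sym (class∘representative (class u)))

  representatives≢ : ∀ {u w} → class u ≢ class w → representative (class u) ≢ representative (class w)
  representatives≢ cu≢cw ru≡rw =
    cu≢cw (trans (sym (class∘representative _)) (trans (cong class ru≡rw) (class∘representative _)))

  adj⇔ : ∀ u w → Adj G u w ⇔ ((class u ≡ class w × u ≢ w) ⊎ Adj H (class u) (class w))
  adj⇔ u w = mk⇔ to from
    where
    to : Adj G u w → (class u ≡ class w × u ≢ w) ⊎ Adj H (class u) (class w)
    to uw = by-classes (class u ≟ᶠ class w)
      where
      by-classes : Dec (class u ≡ class w) → (class u ≡ class w × u ≢ w) ⊎ Adj H (class u) (class w)
      by-classes (yes cu≡cw) = inj₁ (cu≡cw , Adj⇒≢ uw)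
      by-classes (no cu≢cw) = inj₂ (Equivalence.from (Adjᴴ⇔ (class u) (class w))
        (cu≢cw , Adj-sym (Twin-adj (Twin-representative w) (representatives≢ cu≢cw) (Adj-sym ru))))
        where
        ru : Adj G (representative (class u)) w
        ru = Twin-adj (Twin-representative u) (representative≢ cu≢cw ∘ sym) uw
    from : (class u ≡ class w × u ≢ w) ⊎ Adj H (class u) (class w) → Adj G u w
    from (inj₁ (cu≡cw , u≢w)) = Twin⇒Adj (≈⇒Twin (sound cu≡cw)) u≢w
    from (inj₂ e) with Equivalence.to (Adjᴴ⇔ (class u) (class w)) e
    ... | cu≢cw , rr = Adj-sym (Twin-adj (Twin-sym (Twin-representative w)) (λ { refl → cu≢cw refl })
                         (Adj-sym (Twin-adj (Twin-sym (Twin-representative u)) (representative≢ (cu≢cw ∘ sym)) rr)))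

  open BlowUp G H class representative class∘representative adj⇔
  module Hʷ = Walks H

  class-separates : ∀ {a v b} → Adj G a v → d a b ≡ suc (d v b) → NonSimplicial v →
                    ¬ WalkIn G (λ x → class x ≢ class v) a b
  class-separates av dab ns w =
    twins-separate av dab (walkIn-map (λ cx≢cv tw → cx≢cv (complete (inj₂ (tw , NonSimplicial-twin (Twin-sym tw) ns)))) w)

  lift-avoiding : ∀ {Q : Fin size → Set} {v h h′} → (∀ {k} → Q k → k ≢ class v) →
                  WalkIn H Q h h′ → WalkIn G (λ x → class x ≢ class v) (representative h) (representative h′)
  lift-avoiding Q⇒≢ = walkIn-lift λ {k} qk ck≡ → Q⇒≢ qk (trans (sym (class∘representative k)) ck≡)

  block-clique : ∀ S → IsBlock H S → IsClique H S
  block-clique S ((_ , connS , 2connS) , _) p q p∈ q∈ p≢q = decidable-stable (Hʷ.Adj? p q) separated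
    where
    a = representative p
    b = representative q
    p≡q : class a ≡ class b → p ≡ q
    p≡q ca≡cb = trans (sym (class∘representative p)) (trans ca≡cb (class∘representative q))
    a≢b : a ≢ b
    a≢b = p≢q ∘ p≡q ∘ cong class
    ¬ab : ¬ Adj H p q → ¬ Adj G a b
    ¬ab ¬pq ab with Adj⇒ ab
    ... | inj₁ (ca≡cb , _) = p≢q (p≡q ca≡cb)
    ... | inj₂ e = ¬pq (subst₂ (Adj H) (class∘representative p) (class∘representative q) e)
    separated : ¬ ¬ Adj H p q
    separated ¬pq with first-on-geodesic (≤-trans (s≤s z≤n) (≢∧¬Adj⇒d≥2 a≢b (¬ab ¬pq)))
    ... | v , av , dab = class-separates av dab ns (lift-avoiding proj₂ p↝q)
      where
      1≤dvb : 1 ≤ d v b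
      1≤dvb = ≤-pred (subst (2 ≤_) dab (≢∧¬Adj⇒d≥2 a≢b (¬ab ¬pq)))
      ns : NonSimplicial v
      ns = geodesic-interior-NonSimplicial av dab 1≤dvb
      p≢cv : p ≢ class v
      p≢cv p≡cv = 1+n≢n (sym (trans (Twin-d tw b≢v (a≢b ∘ sym)) dab))
        where
        tw : Twin v a
        tw = fibre-Twin (trans (sym p≡cv) (sym (class∘representative p)))
        b≢v : b ≢ v
        b≢v b≡v = 1+n≰n (subst (1 ≤_) (trans (cong (d v) b≡v) (d-refl v)) 1≤dvb)
      q≢cv : q ≢ class v
      q≢cv q≡cv = ¬ab ¬pq (Adj-sym (Twin-adj tw a≢b (Adj-sym av)))
        where
        tw : Twin b v
        tw = fibre-Twin (trans (class∘representative q) q≡cv)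
      p↝q : WalkIn H (λ h → h ∈ₛ S × h ≢ class v) p q
      p↝q with class v ∈? S
      ... | yes cv∈S = 2connS (class v) cv∈S p q (p∈ , p≢cv) (q∈ , q≢cv)
      ... | no cv∉S = Hʷ.walkIn-map (λ h∈ → h∈ , λ { refl → cv∉S h∈ }) (connS p q p∈ q∈)

  NonSimplicial⇒cut : ∀ {u} → NonSimplicial u → IsCutVertex H (class u)
  NonSimplicial⇒cut {u} ns@(a , b , ua , ub , a≢b , ¬ab) = class a , class b , ca≢cu , cb≢cu , separated
    where
    ca≢cu : class a ≢ class u
    ca≢cu ca≡cu = ¬ab (Twin-adj (fibre-Twin ca≡cu) (a≢b ∘ sym) ub)
    cb≢cu : class b ≢ class u
    cb≢cu cb≡cu = ¬ab (Adj-sym (Twin-adj (fibre-Twin cb≡cu) a≢b ua))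
    dab : d a b ≡ suc (d u b)
    dab = trans (d≡2 a≢b ¬ab (Adj-sym ua) ub) (cong suc (sym (Adj⇒d≡1 ub)))
    to-representative : ∀ {x} → class x ≢ class u →
                        WalkIn G (λ y → class y ≢ class u) x (representative (class x))
    to-representative cx≢cu = walkIn-to-representative cx≢cu (cx≢cu ∘ trans (sym (class∘representative _)))
    separated : ¬ WalkIn H (_≢ class u) (class a) (class b)
    separated w = class-separates (Adj-sym ua) dab ns
      (to-representative ca≢cu ++ⁱ lift-avoiding id w ++ⁱ walkIn-reverse (to-representative cb≢cu))

  singleton-fibres : ∀ u w → class u ≡ class w → ¬ IsCutVertex H (class u) → u ≡ w
  singleton-fibres u w cu≡cw ¬cut with sound cu≡cw
  ... | inj₁ u≡w = u≡w
  ... | inj₂ (_ , ns) = contradiction (NonSimplicial⇒cut ns) ¬cut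

  extendedBlockGraph : IsExtendedBlockGraph G
  extendedBlockGraph =
    size , H , (connected-image conn , block-clique) , class ,
    (λ h → representative h , class∘representative h) , singleton-fibres , adj⇔

theorem6 : (n : ℕ) (G : Graph n) → Connected G → (P2 G ⇔ IsExtendedBlockGraph G)
theorem6 n G conn = mk⇔ (P2⇒ExtendedBlockGraph.extendedBlockGraph conn)
  λ (m , H , blockGraph , f , surjective , _ , adj⇔) →
    ExtendedBlockGraph⇒P2.p2 conn blockGraph f (proj₁ ∘ surjective) (proj₂ ∘ surjective) adj⇔
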